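{- Let $(G,H)$ be a Hamiltonian cubic $3$-pole having a segment of length $2$. Then $G$ is $3$-edge-colourable. Moreover, $(G,H)$ has a proper $4$-cover.
   Context: Graphs may have multiple edges and dangling edges (edges with exactly one end vertex); no loops. A Hamiltonian cubic $3$-pole $(G,H)$ is a graph $G$ in which every vertex has degree $3$, with exactly three dangling edges $e_1,e_2,e_3$ (spokes), together with a distinguished circuit $H$ through all vertices. Let $v_i$ be the end vertex of $e_i$. The vertices $v_1,v_2,v_3$ split $H$ into three paths, called segments, each joining two of the $v_i$ and not containing the third; the length of a segment is its number of edges. A $3$-edge-colouring assigns one of three colours to every edge (including dangling edges) so that edges sharing a vertex get distinct colours. A chord is an edge not in $H$; $Q$ is the set of chords. A perfect matching is a set of edges (dangling edges allowed) covering every vertex exactly once. A proper $4$-cover of $(G,H)$ is a set of perfect matchings $M_1,M_2,M_3,M_4$ with every edge in at least one $M_i$, $M_4=Q$, and each spoke lying in exactly two of the $M_i$. -}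

module Defs where

open import Data.Nat using (ℕ; zero; suc)
open import Data.Nat.DivMod using (_mod_)
open import Data.Fin using (Fin; toℕ; fromℕ)
open import Data.Maybe using (Maybe; just; nothing)
open import Data.Product using (Σ; ∃; ∃-syntax; _×_; _,_)
open import Data.Sum using (_⊎_)
open import Relation.Binary.PropositionalEquality using (_≡_; _≢_)
open import Relation.Nullary using (¬_)
open import Function.Definitions using (Injective)

next : ∀ {n} → Fin n → Fin n
next {suc k} i = suc (toℕ i) mod suc k

-- A (finite) graph with possible multiple edges and dangling edges, no loops.  Edge e has a first end vertex
-- end₁ e and a second end end₂ e, which is `nothing` iff e is dangling.
record Graph : Set where
  field
    nV nE  : ℕ
    end₁   : Fin nE → Fin nV
    end₂   : Fin nE → Maybe (Fin nV)
    noLoop : ∀ e w → end₂ e ≡ just w → w ≢ end₁ e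

module _ (G : Graph) where
  open Graph G

  Incident : Fin nE → Fin nV → Set
  Incident e v = end₁ e ≡ v ⊎ end₂ e ≡ just v

  Dangling : Fin nE → Set
  Dangling e = end₂ e ≡ nothing

  Joins : Fin nE → Fin nV → Fin nV → Set
  Joins e u w = (end₁ e ≡ u × end₂ e ≡ just w) ⊎ (end₁ e ≡ w × end₂ e ≡ just u)

  Enumerates : (Fin 3 → Fin nE) → (Fin nE → Set) → Set
  Enumerates f P = Injective _≡_ _≡_ f × (∀ k → P (f k)) × (∀ e → P e → ∃[ k ] f k ≡ e)

  Cubic : Set
  Cubic = ∀ v → ∃[ f ] Enumerates f (λ e → Incident e v)

  EdgeColouring : (Fin nE → Fin 3) → Set
  EdgeColouring col = ∀ e e' v → e ≢ e' → Incident e v → Incident e' v → col e ≢ col e'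

  ThreeEdgeColourable : Set
  ThreeEdgeColourable = ∃[ col ] EdgeColouring col

  PerfectMatching : (Fin nE → Set) → Set
  PerfectMatching M = ∀ v → ∃[ e ] (M e × Incident e v ×
                        (∀ e' → M e' → Incident e' v → e' ≡ e))

-- A Hamiltonian cubic 3-pole (G,H): G cubic with exactly three dangling edges
-- (the spokes, enumerated by `spoke`) and a Hamiltonian circuit H given as a
-- cyclic sequence of vertices `cyc 0, cyc 1, …, cyc (nV-1)` (all vertices, each
-- once) and distinct edges `hEdge i` joining `cyc i` and `cyc (next i)`.
record Ham3Pole (G : Graph) : Set where
  open Graph G
  field
    cubic     : Cubic G
    spoke     : Fin 3 → Fin nE
    spokes    : Enumerates G spoke (Dangling G)
    cyc       : Fin nV → Fin nV
    cycInj    : Injective _≡_ _≡_ cyc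
    cycSurj   : ∀ v → ∃[ i ] cyc i ≡ v
    hEdge     : Fin nV → Fin nE
    hEdgeInj  : Injective _≡_ _≡_ hEdge
    hEdgeJoin : ∀ i → Joins G (hEdge i) (cyc i) (cyc (next i))

module _ {G : Graph} (P : Ham3Pole G) where
  open Graph G
  open Ham3Pole P

  InH : Fin nE → Set
  InH e = ∃[ i ] hEdge i ≡ e

  -- chords: edges not in H (this includes the spokes)
  Chord : Fin nE → Set
  Chord e = ¬ InH e

  spokeEnd : Fin 3 → Fin nV
  spokeEnd i = end₁ (spoke i)

  HasSegmentOfLength2 : Set
  HasSegmentOfLength2 = ∃[ i ] ∃[ j ] ∃[ p ] (i ≢ j × cyc p ≡ spokeEnd i ×
                          (∀ k → cyc (next p) ≢ spokeEnd k) ×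
                          cyc (next (next p)) ≡ spokeEnd j)

  -- proper 4-cover: M i = M_{i+1}; M 3 = Q
  Proper4Cover : (Fin 4 → Fin nE → Set) → Set
  Proper4Cover M =
    (∀ i → PerfectMatching G (M i)) ×
    (∀ e → ∃[ i ] M i e) ×
    (∀ e → (M (fromℕ 3) e → Chord e) × (Chord e → M (fromℕ 3) e)) ×
    (∀ s → ∃[ i ] ∃[ j ] (i ≢ j × M i (spoke s) × M j (spoke s) ×
                          (∀ k → M k (spoke s) → k ≡ i ⊎ k ≡ j)))

  HasProper4Cover : Set₁
  HasProper4Cover = ∃[ M ] Proper4Cover M

module Submission where

-- Number the positions of the circuit H from v_i, so that the segment of length 2 is
-- v_i, b, v_j at offsets 0, 1, 2.  If H is even, colour it alternately 0, 1 and every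
-- chord 2.  If H is odd, the circuit edges at offsets 2, 4, …, n − 1 form a matching τ
-- covering every vertex except b, and the chords other than the spokes form a matching
-- σ covering every vertex except the three spoke ends.  Colouring the remaining circuit
-- edges 0, the τ-edges 2 and the chords 1 fails only around b.  The component of b in
-- σ ∪ τ is a path starting at b, so it ends in at most one of v_i and v_j; swapping 1 and
-- 2 along it (a Kempe switch), and giving colour 0 to the spoke at an end of the segment
-- off the path and to the segment edge not incident with it, repairs the colouring.
-- The three colour classes of any 3-edge-colouring, together with the chords, form a
-- proper 4-cover.

open import Defs
open import Data.Bool using (Bool; true; false; not; if_then_else_)
open import Data.Bool.Properties using (not-involutive; not-injective; ¬-not) renaming (_≟_ to _≟ᵇ_)
open import Data.Empty using (⊥; ⊥-elim)
open import Data.Fin using (Fin; zero; suc; toℕ; fromℕ<; inject₁)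
open import Data.Fin.Patterns using (0F; 1F; 2F; 3F)
open import Data.Fin.Properties
  using (any?; pigeonhole; toℕ-fromℕ<; toℕ-injective; toℕ<n; toℕ≤pred[n]; nonZeroIndex; fromℕ≢inject₁)
  renaming (_≟_ to _≟ᶠ_)
open import Data.Maybe using (Maybe; just; nothing; _>>=_)
import Data.Maybe as Maybe
open import Data.Maybe.Properties using (just-injective; ≡-dec)
open import Data.Nat using (ℕ; zero; suc; pred; _+_; _∸_; _<_; _≤_; z≤n; s≤s; s<s⁻¹; NonZero; _%_)
open import Data.Nat.DivMod using (%-distribˡ-+; m%n%n≡m%n; m%n<n; n%n≡0; [m+n]%n≡m%n; m<n⇒m%n≡m)
open import Data.Nat.Properties
  using ( +-comm; +-assoc; +-suc; m+[n∸m]≡n; suc-pred; m≤m+n; m≤n+m; ≤-refl; ≤-antisym; <⇒≤; <⇒≢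
        ; <-irrefl; n<1+n; m≤n⇒m<n∨m≡n; _≤?_; ≰⇒>)
open import Data.Product using (Σ-syntax; ∃-syntax; _×_; _,_; proj₁; proj₂)
open import Data.Sum using (_⊎_; inj₁; inj₂; swap)
open import Data.Vec.Functional using (_∷_)
open import Function using (_∘_; id; case_of_)
open import Function.Bundles using (mk⇔)
open import Function.Definitions using (Injective)
open import Relation.Binary.PropositionalEquality
  using (_≡_; _≢_; refl; sym; trans; cong; subst; module ≡-Reasoning)
open import Relation.Nullary using (¬_; Dec; yes; no; does)
open import Relation.Nullary.Decidable using (dec-true; does-⇔)

nothing≢just : ∀ {A : Set} {x : A} → nothing ≢ just x
nothing≢just ()

Distinct₃ : {A : Set} → A → A → A → Set
Distinct₃ x y z = x ≢ y × x ≢ z × y ≢ z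

Distinct₃-cong : ∀ {A : Set} {x y z x' y' z' : A} →
                 x ≡ x' → y ≡ y' → z ≡ z' → Distinct₃ x' y' z' → Distinct₃ x y z
Distinct₃-cong refl refl refl d = d

injective⇒surjective : ∀ {n} (f : Fin n → Fin n) → Injective _≡_ _≡_ f → ∀ k → ∃[ i ] f i ≡ k
injective⇒surjective {n} f f-inj k with any? (λ i → f i ≟ᶠ k)
... | yes hit = hit
... | no miss with pigeonhole (n<1+n n) (k ∷ f)
...   | zero  , suc j , _   , k≡fj  = ⊥-elim (miss (j , sym k≡fj))
...   | suc i , suc j , i<j , fi≡fj = ⊥-elim (<-irrefl (cong toℕ (f-inj fi≡fj)) (s<s⁻¹ i<j))

Fin3-third : (a b : Fin 3) → a ≢ b → ∃[ c ] (c ≢ a × c ≢ b × (∀ d → d ≢ a → d ≢ b → d ≡ c))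
Fin3-third 0F 1F _ = 2F , (λ ()) , (λ ()) , λ where
  0F d≢a _ → ⊥-elim (d≢a refl)
  1F _ d≢b → ⊥-elim (d≢b refl)
  2F _ _   → refl
Fin3-third 0F 2F _ = 1F , (λ ()) , (λ ()) , λ where
  0F d≢a _ → ⊥-elim (d≢a refl)
  1F _ _   → refl
  2F _ d≢b → ⊥-elim (d≢b refl)
Fin3-third 1F 0F _ = 2F , (λ ()) , (λ ()) , λ where
  0F _ d≢b → ⊥-elim (d≢b refl)
  1F d≢a _ → ⊥-elim (d≢a refl)
  2F _ _   → refl
Fin3-third 1F 2F _ = 0F , (λ ()) , (λ ()) , λ where
  0F _ _   → refl
  1F d≢a _ → ⊥-elim (d≢a refl)
  2F _ d≢b → ⊥-elim (d≢b refl)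
Fin3-third 2F 0F _ = 1F , (λ ()) , (λ ()) , λ where
  0F _ d≢b → ⊥-elim (d≢b refl)
  1F _ _   → refl
  2F d≢a _ → ⊥-elim (d≢a refl)
Fin3-third 2F 1F _ = 0F , (λ ()) , (λ ()) , λ where
  0F _ _   → refl
  1F _ d≢b → ⊥-elim (d≢b refl)
  2F d≢a _ → ⊥-elim (d≢a refl)
Fin3-third 0F 0F a≢b = ⊥-elim (a≢b refl)
Fin3-third 1F 1F a≢b = ⊥-elim (a≢b refl)
Fin3-third 2F 2F a≢b = ⊥-elim (a≢b refl)

module _ (G : Graph) where
  open Graph G

  joins-incidentˡ : ∀ {e u w} → Joins G e u w → Incident G e u
  joins-incidentˡ (inj₁ (e₁≡u , _)) = inj₁ e₁≡u
  joins-incidentˡ (inj₂ (_ , e₂≡u)) = inj₂ e₂≡u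

  joins-incidentʳ : ∀ {e u w} → Joins G e u w → Incident G e w
  joins-incidentʳ = joins-incidentˡ ∘ swap

  joins-distinct : ∀ {e u w} → Joins G e u w → u ≢ w
  joins-distinct (inj₁ (e₁≡u , e₂≡w)) refl = noLoop _ _ e₂≡w (sym e₁≡u)
  joins-distinct (inj₂ (e₁≡w , e₂≡u)) refl = noLoop _ _ e₂≡u (sym e₁≡w)

  joins-not-dangling : ∀ {e u w} → Joins G e u w → ¬ Dangling G e
  joins-not-dangling (inj₁ (_ , e₂≡w)) dangling = nothing≢just (trans (sym dangling) e₂≡w)
  joins-not-dangling (inj₂ (_ , e₂≡u)) dangling = nothing≢just (trans (sym dangling) e₂≡u)

  enumerated-third : ∀ {f P e₁ e₂} → Enumerates G f P → P e₁ → P e₂ → e₁ ≢ e₂ →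
                     ∃[ e ] (P e × e ≢ e₁ × e ≢ e₂ × (∀ {e'} → P e' → e' ≢ e₁ → e' ≢ e₂ → e' ≡ e))
  enumerated-third {f} {P} (f-inj , f-P , f-onto) Pe₁ Pe₂ e₁≢e₂
    with a , refl ← f-onto _ Pe₁ | b , refl ← f-onto _ Pe₂
    with c , c≢a , c≢b , only-c ← Fin3-third a b (λ a≡b → e₁≢e₂ (cong f a≡b))
    = f c , f-P c , (λ eq → c≢a (f-inj eq)) , (λ eq → c≢b (f-inj eq)) , only-fc
    where
    only-fc : ∀ {e'} → P e' → e' ≢ f a → e' ≢ f b → e' ≡ f c
    only-fc Pe' e'≢fa e'≢fb with d , refl ← f-onto _ Pe' =
      cong f (only-c d (λ d≡a → e'≢fa (cong f d≡a)) (λ d≡b → e'≢fb (cong f d≡b)))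

  colour-injective-at-vertex : ∀ {col v f} → EdgeColouring G col → Enumerates G f (λ e → Incident G e v) →
                               Injective _≡_ _≡_ (col ∘ f)
  colour-injective-at-vertex {v = v} {f} proper (f-inj , f-inc , _) {a} {b} same with a ≟ᶠ b
  ... | yes a≡b = a≡b
  ... | no a≢b  = ⊥-elim (proper (f a) (f b) v (λ fa≡fb → a≢b (f-inj fa≡fb)) (f-inc a) (f-inc b) same)

  colourClass-perfectMatching : Cubic G → ∀ {col} → EdgeColouring G col → ∀ k →
                                PerfectMatching G (λ e → col e ≡ k)
  colourClass-perfectMatching cubic {col} proper k v
    with f , f-enum@(_ , f-inc , _) ← cubic v
    with a , col-fa≡k ← injective⇒surjective _ (colour-injective-at-vertex proper f-enum) k
    = f a , col-fa≡k , f-inc a , only-fa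
    where
    only-fa : ∀ e → col e ≡ k → Incident G e v → e ≡ f a
    only-fa e col-e≡k e-inc with e ≟ᶠ f a
    ... | yes e≡fa = e≡fa
    ... | no e≢fa  = ⊥-elim (proper e (f a) v e≢fa e-inc (f-inc a) (trans col-e≡k (sym col-fa≡k)))

-- Cyclic order on Fin n

[m%n+k]%n≡[m+k]%n : ∀ m k n .{{_ : NonZero n}} → (m % n + k) % n ≡ (m + k) % n
[m%n+k]%n≡[m+k]%n m k n = begin
  (m % n + k) % n          ≡⟨ %-distribˡ-+ (m % n) k n ⟩
  (m % n % n + k % n) % n  ≡⟨ cong (λ x → (x + k % n) % n) (m%n%n≡m%n m n) ⟩
  (m % n + k % n) % n      ≡⟨ %-distribˡ-+ m k n ⟨
  (m + k) % n              ∎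
  where open ≡-Reasoning

[m+k%n]%n≡[m+k]%n : ∀ m k n .{{_ : NonZero n}} → (m + k % n) % n ≡ (m + k) % n
[m+k%n]%n≡[m+k]%n m k n = begin
  (m + k % n) % n  ≡⟨ cong (_% n) (+-comm m (k % n)) ⟩
  (k % n + m) % n  ≡⟨ [m%n+k]%n≡[m+k]%n k m n ⟩
  (k + m) % n      ≡⟨ cong (_% n) (+-comm k m) ⟩
  (m + k) % n      ∎
  where open ≡-Reasoning

toℕ-next : ∀ {n} .{{_ : NonZero n}} (q : Fin n) → toℕ (next q) ≡ suc (toℕ q) % n
toℕ-next {suc _} q = toℕ-fromℕ< _

module Cyclic {n : ℕ} {{_ : NonZero n}} where
  open ≡-Reasoning

  [x+n]%n≡x : ∀ {x} → x < n → (x + n) % n ≡ x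
  [x+n]%n≡x {x} x<n = trans ([m+n]%n≡m%n x n) (m<n⇒m%n≡m x<n)

  [1+x+pred[n]]%n≡x : ∀ {x} → x < n → suc (x + pred n) % n ≡ x
  [1+x+pred[n]]%n≡x {x} x<n = begin
    suc (x + pred n) % n    ≡⟨ cong (_% n) (+-suc x (pred n)) ⟨
    (x + suc (pred n)) % n  ≡⟨ cong (λ m → (x + m) % n) (suc-pred n) ⟩
    (x + n) % n             ≡⟨ [x+n]%n≡x x<n ⟩
    x                       ∎

  prev : Fin n → Fin n
  prev q = fromℕ< (m%n<n (toℕ q + pred n) n)

  next-prev : ∀ q → next (prev q) ≡ q
  next-prev q = toℕ-injective (begin
    toℕ (next (prev q))             ≡⟨ toℕ-next (prev q) ⟩
    suc (toℕ (prev q)) % n          ≡⟨ cong (λ x → suc x % n) (toℕ-fromℕ< _) ⟩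
    (1 + (toℕ q + pred n) % n) % n  ≡⟨ [m+k%n]%n≡[m+k]%n 1 (toℕ q + pred n) n ⟩
    suc (toℕ q + pred n) % n        ≡⟨ [1+x+pred[n]]%n≡x (toℕ<n q) ⟩
    toℕ q                           ∎)

  prev-next : ∀ q → prev (next q) ≡ q
  prev-next q = toℕ-injective (begin
    toℕ (prev (next q))             ≡⟨ toℕ-fromℕ< _ ⟩
    (toℕ (next q) + pred n) % n     ≡⟨ cong (λ x → (x + pred n) % n) (toℕ-next q) ⟩
    (suc (toℕ q) % n + pred n) % n  ≡⟨ [m%n+k]%n≡[m+k]%n (suc (toℕ q)) (pred n) n ⟩
    suc (toℕ q + pred n) % n        ≡⟨ [1+x+pred[n]]%n≡x (toℕ<n q) ⟩
    toℕ q                           ∎)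

  prev⇒next : ∀ {q r} → prev q ≡ r → q ≡ next r
  prev⇒next {q} pq≡r = trans (sym (next-prev q)) (cong next pq≡r)

  next⇒prev : ∀ {q r} → next r ≡ q → r ≡ prev q
  next⇒prev {r = r} nr≡q = trans (sym (prev-next r)) (cong prev nr≡q)

  offset : Fin n → Fin n → ℕ
  offset p q = (toℕ q + (n ∸ toℕ p)) % n

  module _ (p : Fin n) where

    toℕ+[n∸toℕ]≡n : toℕ p + (n ∸ toℕ p) ≡ n
    toℕ+[n∸toℕ]≡n = m+[n∸m]≡n (<⇒≤ (toℕ<n p))

    offset-self : offset p p ≡ 0
    offset-self = trans (cong (_% n) toℕ+[n∸toℕ]≡n) (n%n≡0 n)

    offset-next : ∀ q → offset p (next q) ≡ suc (offset p q) % n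
    offset-next q = begin
      (toℕ (next q) + (n ∸ toℕ p)) % n     ≡⟨ cong (λ x → (x + (n ∸ toℕ p)) % n) (toℕ-next q) ⟩
      (suc (toℕ q) % n + (n ∸ toℕ p)) % n  ≡⟨ [m%n+k]%n≡[m+k]%n (suc (toℕ q)) (n ∸ toℕ p) n ⟩
      suc (toℕ q + (n ∸ toℕ p)) % n        ≡⟨ [m+k%n]%n≡[m+k]%n 1 (toℕ q + (n ∸ toℕ p)) n ⟨
      suc (offset p q) % n                 ∎

    [offset+toℕ]%n≡toℕ : ∀ q → (offset p q + toℕ p) % n ≡ toℕ q
    [offset+toℕ]%n≡toℕ q = begin
      ((toℕ q + (n ∸ toℕ p)) % n + toℕ p) % n  ≡⟨ [m%n+k]%n≡[m+k]%n (toℕ q + (n ∸ toℕ p)) (toℕ p) n ⟩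
      (toℕ q + (n ∸ toℕ p) + toℕ p) % n        ≡⟨ cong (_% n) (+-assoc (toℕ q) (n ∸ toℕ p) (toℕ p)) ⟩
      (toℕ q + ((n ∸ toℕ p) + toℕ p)) % n      ≡⟨ cong (λ x → (toℕ q + x) % n) (+-comm (n ∸ toℕ p) (toℕ p)) ⟩
      (toℕ q + (toℕ p + (n ∸ toℕ p))) % n      ≡⟨ cong (λ x → (toℕ q + x) % n) toℕ+[n∸toℕ]≡n ⟩
      (toℕ q + n) % n                          ≡⟨ [x+n]%n≡x (toℕ<n q) ⟩
      toℕ q                                    ∎

    offset-injective : Injective _≡_ _≡_ (offset p)
    offset-injective {q} {r} same = toℕ-injective (begin
      toℕ q                     ≡⟨ [offset+toℕ]%n≡toℕ q ⟨
      (offset p q + toℕ p) % n  ≡⟨ cong (λ x → (x + toℕ p) % n) same ⟩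
      (offset p r + toℕ p) % n  ≡⟨ [offset+toℕ]%n≡toℕ r ⟩
      toℕ r                     ∎)

    offset-next-cases : ∀ q → offset p (next q) ≡ suc (offset p q) ⊎ offset p (next q) ≡ 0
    offset-next-cases q with m≤n⇒m<n∨m≡n (m%n<n (toℕ q + (n ∸ toℕ p)) n)
    ... | inj₁ 1+o<n = inj₁ (trans (offset-next q) (m<n⇒m%n≡m 1+o<n))
    ... | inj₂ 1+o≡n = inj₂ (trans (offset-next q) (trans (cong (_% n) 1+o≡n) (n%n≡0 n)))

-- Alternating paths in the union of two matchings

record IsMatching {n : ℕ} (μ : Fin n → Maybe (Fin n)) : Set where
  field
    symmetric   : ∀ {v w} → μ v ≡ just w → μ w ≡ just v
    irreflexive : ∀ {v} → μ v ≢ just v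

even : ℕ → Bool
even zero    = true
even (suc t) = not (even t)

module AlternatingPath {n : ℕ} {σ τ : Fin n → Maybe (Fin n)} (σ-matching : IsMatching σ)
                       (τ-matching : IsMatching τ) (b : Fin n) (τb≡nothing : τ b ≡ nothing) where
  open IsMatching

  step : Bool → Fin n → Maybe (Fin n)
  step true  = σ
  step false = τ

  step-matching : ∀ c → IsMatching (step c)
  step-matching true  = σ-matching
  step-matching false = τ-matching

  walk : ℕ → Maybe (Fin n)
  walk zero    = just b
  walk (suc t) = walk t >>= step (even t)

  walk-forward : ∀ t {v} → walk t ≡ just v → walk (suc t) ≡ step (even t) v
  walk-forward t wt rewrite wt = refl

  walk-back : ∀ t {w} → walk (suc t) ≡ just w → ∃[ v ] (walk t ≡ just v × step (even t) w ≡ just v)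
  walk-back t ws with walk t
  ... | just v = v , refl , symmetric (step-matching (even t)) ws

  walk-prefix : ∀ {s t x} → t ≤ s → walk s ≡ just x → ∃[ v ] walk t ≡ just v
  walk-prefix {zero}  z≤n   ws = _ , ws
  walk-prefix {suc s} t≤1+s ws with m≤n⇒m<n∨m≡n t≤1+s
  ... | inj₂ refl      = _ , ws
  ... | inj₁ (s≤s t≤s) = walk-prefix t≤s (proj₁ (proj₂ (walk-back s ws)))

  InjectiveUpTo : ℕ → Set
  InjectiveUpTo s = ∀ {t t' x} → t ≤ s → t' ≤ s → walk t ≡ just x → walk t' ≡ just x → t ≡ t'

  revisit-b-impossible : ∀ {s v} → InjectiveUpTo s → 1 ≤ s → walk s ≡ just v → step (even s) b ≡ just v → ⊥
  revisit-b-impossible {s} inj 1≤s ws μb≡v with even s in even-s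
  ... | false = nothing≢just (trans (sym τb≡nothing) μb≡v)
  ... | true with refl ← inj 1≤s ≤-refl μb≡v ws = case even-s of λ ()

  revisit-later-impossible : ∀ {s t x v} → InjectiveUpTo s → suc t < s →
                             walk (suc t) ≡ just x → walk s ≡ just v → step (even s) x ≡ just v → ⊥
  revisit-later-impossible {s} {t} {x} inj 1+t<s wt ws μx≡v
    with u , wt' , μx≡u ← walk-back t wt | even t ≟ᵇ even s
  ... | yes same =
    let v≡u = just-injective (trans (sym μx≡v) (trans (cong (λ c → step c x) (sym same)) μx≡u))
    in  <-irrefl (inj (<⇒≤ (<⇒≤ 1+t<s)) ≤-refl wt' (trans ws (cong just v≡u))) (<⇒≤ 1+t<s)
  ... | no differ =
    let flipped = trans (cong not (¬-not differ)) (not-involutive (even s))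
        2+t≡s   = inj 1+t<s ≤-refl (trans (walk-forward (suc t) wt) (trans (cong (λ c → step c x) flipped) μx≡v)) ws
    in  differ (trans (sym (not-involutive (even t))) (cong even 2+t≡s))

  revisit-impossible : ∀ {s} → InjectiveUpTo s → ∀ {t x} → t ≤ s → walk t ≡ just x → walk (suc s) ≡ just x → ⊥
  revisit-impossible {s} inj {t} t≤s wt ws' with v , ws , μx≡v ← walk-back s ws' | m≤n⇒m<n∨m≡n t≤s
  ... | inj₂ refl =
    irreflexive (step-matching (even s)) (trans μx≡v (cong just (just-injective (trans (sym ws) wt))))
  ... | inj₁ t<s with t
  ...   | zero   = revisit-b-impossible inj t<s ws (subst (λ y → step (even s) y ≡ just v) (sym (just-injective wt)) μx≡v)
  ...   | suc _  = revisit-later-impossible inj t<s wt ws μx≡v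

  injectiveUpTo : ∀ s → InjectiveUpTo s
  injectiveUpTo zero    z≤n z≤n _ _ = refl
  injectiveUpTo (suc s) t≤ t'≤ wt wt' with m≤n⇒m<n∨m≡n t≤ | m≤n⇒m<n∨m≡n t'≤
  ... | inj₂ refl      | inj₂ refl       = refl
  ... | inj₁ (s≤s t≤s) | inj₁ (s≤s t'≤s) = injectiveUpTo s t≤s t'≤s wt wt'
  ... | inj₁ (s≤s t≤s) | inj₂ refl       = ⊥-elim (revisit-impossible (injectiveUpTo s) t≤s wt wt')
  ... | inj₂ refl      | inj₁ (s≤s t'≤s) = ⊥-elim (revisit-impossible (injectiveUpTo s) t'≤s wt' wt)

  walk-injective : ∀ {t t' x} → walk t ≡ just x → walk t' ≡ just x → t ≡ t'
  walk-injective {t} {t'} = injectiveUpTo (t + t') (m≤m+n t t') (m≤n+m t' t)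

  no-walk-of-length-n : ∀ {x} → walk n ≡ just x → ⊥
  no-walk-of-length-n wn
    with i , j , i<j , same ← pigeonhole (n<1+n n) (λ i → proj₁ (walk-prefix (toℕ≤pred[n] i) wn))
    = <⇒≢ i<j (walk-injective (visited i) (subst (λ y → walk (toℕ j) ≡ just y) (sym same) (visited j)))
    where
    visited : ∀ i → walk (toℕ i) ≡ just (proj₁ (walk-prefix (toℕ≤pred[n] i) wn))
    visited i = proj₂ (walk-prefix (toℕ≤pred[n] i) wn)

  walk-stops : walk n ≡ nothing
  walk-stops with walk n in wn
  ... | nothing = refl
  ... | just _  = ⊥-elim (no-walk-of-length-n wn)

  walk-defined⇒≤ : ∀ {t t' x} → walk (suc t) ≡ nothing → walk t' ≡ just x → t' ≤ t
  walk-defined⇒≤ {t} {t'} stopped wt' with t' ≤? t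
  ... | yes t'≤t = t'≤t
  ... | no t'≰t  = ⊥-elim (nothing≢just (trans (sym stopped) (proj₂ (walk-prefix (≰⇒> t'≰t) wt'))))

  walk-bounded : ∀ {t v} → walk t ≡ just v → t < n
  walk-bounded {t} wt = ≰⇒> λ n≤t → nothing≢just (trans (sym walk-stops) (proj₂ (walk-prefix {t} n≤t wt)))

  -- Indexing by Fin n makes OnPath decidable; walk-bounded shows that no step is missed.
  OnPath : Fin n → Set
  OnPath v = Σ[ i ∈ Fin n ] walk (toℕ i) ≡ just v

  onPath? : ∀ v → Dec (OnPath v)
  onPath? v = any? (λ i → ≡-dec _≟ᶠ_ (walk (toℕ i)) (just v))

  visited⇒OnPath : ∀ t {v} → walk t ≡ just v → OnPath v
  visited⇒OnPath t {v} wt = fromℕ< t<n , subst (λ s → walk s ≡ just v) (sym (toℕ-fromℕ< t<n)) wt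
    where
    t<n : t < n
    t<n = walk-bounded wt

  visited-neighbour : ∀ t c {v w} → walk t ≡ just v → step c v ≡ just w → ∃[ t' ] walk t' ≡ just w
  visited-neighbour t c wt μv≡w with even t ≟ᵇ c
  visited-neighbour t       _     wt   μv≡w | yes refl  = suc t , trans (walk-forward t wt) μv≡w
  visited-neighbour zero    true  _    _    | no differ = ⊥-elim (differ refl)
  visited-neighbour zero    false refl τb≡w | no _      = ⊥-elim (nothing≢just (trans (sym τb≡nothing) τb≡w))
  visited-neighbour (suc t) c {v} wt μv≡w   | no differ with u , wt' , μv≡u ← walk-back t wt =
    t , subst (λ y → walk t ≡ just y) u≡w wt'
    where
    u≡w = just-injective (trans (sym μv≡u) (trans (cong (λ c → step c v) (not-injective (¬-not differ))) μv≡w))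

  OnPath-closed : ∀ c {v w} → step c v ≡ just w → OnPath v → OnPath w
  OnPath-closed c μv≡w (i , wi) = let t , wt = visited-neighbour (toℕ i) c wi μv≡w in visited⇒OnPath t wt

  walk-ends-at-σ-unmatched : ∀ t {a} → walk t ≡ just a → a ≢ b → σ a ≡ nothing → walk (suc t) ≡ nothing
  walk-ends-at-σ-unmatched zero    wt a≢b _ = ⊥-elim (a≢b (sym (just-injective wt)))
  walk-ends-at-σ-unmatched (suc t) {a} wt _ σa≡nothing with u , _ , μa≡u ← walk-back t wt =
    trans (walk-forward (suc t) wt) (stop (even t) μa≡u)
    where
    stop : ∀ c → step c a ≡ just u → step (not c) a ≡ nothing
    stop true  σa≡u = ⊥-elim (nothing≢just (trans (sym σa≡nothing) σa≡u))
    stop false _    = σa≡nothing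

  onPath : Fin n → Bool
  onPath v = does (onPath? v)

  onPath-start : onPath b ≡ true
  onPath-start = dec-true (onPath? b) (visited⇒OnPath 0 refl)

  onPath-step : ∀ c {v w} → step c v ≡ just w → onPath v ≡ onPath w
  onPath-step c μv≡w =
    does-⇔ (mk⇔ (OnPath-closed c μv≡w) (OnPath-closed c (symmetric (step-matching c) μv≡w))) (onPath? _) (onPath? _)

  σ-unmatched-separated : ∀ {a c} → a ≢ b → c ≢ b → a ≢ c → σ a ≡ nothing → σ c ≡ nothing →
                          onPath a ≡ false ⊎ onPath c ≡ false
  σ-unmatched-separated {a} {c} a≢b c≢b a≢c σa σc with onPath? a | onPath? c
  ... | no _         | _            = inj₁ refl
  ... | yes _        | no _         = inj₂ refl
  ... | yes (i , wa) | yes (j , wc) =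
    ⊥-elim (a≢c (just-injective (trans (sym wa) (subst (λ t → walk t ≡ just c) (sym i≡j) wc))))
    where
    i≡j : toℕ i ≡ toℕ j
    i≡j = ≤-antisym (walk-defined⇒≤ (walk-ends-at-σ-unmatched (toℕ j) wc c≢b σc) wa)
                    (walk-defined⇒≤ (walk-ends-at-σ-unmatched (toℕ i) wa a≢b σa) wc)

-- A vertex is handled through its position q on the circuit (the vertex cyc q): the circuit
-- edge hEdge q leaves it and hEdge (prev q) enters it.
module Circuit {G : Graph} (P : Ham3Pole G) where
  open Graph G
  open Ham3Pole P

  instance
    nV-nonZero : NonZero nV
    nV-nonZero = nonZeroIndex (spokeEnd P 0F)

  open Cyclic {nV} public

  position : Fin nV → Fin nV
  position v = proj₁ (cycSurj v)

  cyc-position : ∀ v → cyc (position v) ≡ v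
  cyc-position v = proj₂ (cycSurj v)

  position-cyc : ∀ q → position (cyc q) ≡ q
  position-cyc q = cycInj (cyc-position (cyc q))

  next≢ : ∀ q → next q ≢ q
  next≢ q nq≡q = joins-distinct G (hEdgeJoin q) (cong cyc (sym nq≡q))

  prev≢ : ∀ q → prev q ≢ q
  prev≢ q pq≡q = next≢ q (trans (cong next (sym pq≡q)) (next-prev q))

  hEdge-into : ∀ q → Incident G (hEdge (prev q)) (cyc q)
  hEdge-into q = subst (λ r → Incident G (hEdge (prev q)) (cyc r)) (next-prev q) (joins-incidentʳ G (hEdgeJoin (prev q)))

  hEdge-incident : ∀ {r q} → Incident G (hEdge r) (cyc q) → r ≡ q ⊎ r ≡ prev q
  hEdge-incident {r} inc with hEdgeJoin r | inc
  ... | inj₁ (e₁≡ , _) | inj₁ e₁≡q = inj₁ (cycInj (trans (sym e₁≡) e₁≡q))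
  ... | inj₁ (_ , e₂≡) | inj₂ e₂≡q = inj₂ (next⇒prev (cycInj (just-injective (trans (sym e₂≡) e₂≡q))))
  ... | inj₂ (e₁≡ , _) | inj₁ e₁≡q = inj₂ (next⇒prev (cycInj (trans (sym e₁≡) e₁≡q)))
  ... | inj₂ (_ , e₂≡) | inj₂ e₂≡q = inj₁ (cycInj (just-injective (trans (sym e₂≡) e₂≡q)))

  InH? : ∀ e → Dec (InH P e)
  InH? e = any? (λ r → hEdge r ≟ᶠ e)

  unique-chord : ∀ q → ∃[ e ] (Incident G e (cyc q) × Chord P e ×
                              (∀ {e'} → Incident G e' (cyc q) → Chord P e' → e' ≡ e))
  unique-chord q
    with f , f-enum ← cubic (cyc q)
    with e , e-inc , e≢out , e≢in , only-e ←
           enumerated-third G f-enum (joins-incidentˡ G (hEdgeJoin q)) (hEdge-into q) (λ eq → prev≢ q (sym (hEdgeInj eq)))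
    = e , e-inc , e-chord , λ e'-inc e'-chord → only-e e'-inc (λ eq → e'-chord (q , sym eq)) (λ eq → e'-chord (prev q , sym eq))
    where
    e-chord : Chord P e
    e-chord (r , refl) with hEdge-incident e-inc
    ... | inj₁ refl = e≢out refl
    ... | inj₂ refl = e≢in refl

  chordAt : Fin nV → Fin nE
  chordAt q = proj₁ (unique-chord q)

  chordAt-incident : ∀ q → Incident G (chordAt q) (cyc q)
  chordAt-incident q = proj₁ (proj₂ (unique-chord q))

  chordAt-chord : ∀ q → Chord P (chordAt q)
  chordAt-chord q = proj₁ (proj₂ (proj₂ (unique-chord q)))

  chordAt-unique : ∀ {q e} → Incident G e (cyc q) → Chord P e → e ≡ chordAt q
  chordAt-unique {q} = proj₂ (proj₂ (proj₂ (unique-chord q)))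

  chords-perfectMatching : PerfectMatching G (Chord P)
  chords-perfectMatching v =
    chordAt q , chordAt-chord q , subst (Incident G (chordAt q)) (cyc-position v) (chordAt-incident q) ,
    λ e e-chord e-inc → chordAt-unique (subst (Incident G e) (sym (cyc-position v)) e-inc) e-chord
    where
    q = position v

  spoke-dangling : ∀ s → Dangling G (spoke s)
  spoke-dangling = proj₁ (proj₂ spokes)

  spoke-chord : ∀ s → Chord P (spoke s)
  spoke-chord s (r , hr≡s) = joins-not-dangling G (hEdgeJoin r) (subst (Dangling G) (sym hr≡s) (spoke-dangling s))

  spokeEnd-injective : ∀ {s s'} → spokeEnd P s ≡ spokeEnd P s' → s ≡ s'
  spokeEnd-injective {s} {s'} same = proj₁ spokes (trans (chord-at s refl) (sym (chord-at s' (sym same))))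
    where
    chord-at : ∀ s'' → spokeEnd P s'' ≡ spokeEnd P s → spoke s'' ≡ chordAt (position (spokeEnd P s))
    chord-at s'' eq = chordAt-unique (inj₁ (trans eq (sym (cyc-position _)))) (spoke-chord s'')

  partner : Fin nV → Maybe (Fin nV)
  partner q with end₁ (chordAt q) ≟ᶠ cyc q
  ... | yes _ = Maybe.map position (end₂ (chordAt q))
  ... | no _  = just (position (end₁ (chordAt q)))

  map-position≡just : ∀ {m r} → Maybe.map position m ≡ just r → m ≡ just (cyc r)
  map-position≡just {just w} eq = cong just (trans (sym (cyc-position w)) (cong cyc (just-injective eq)))

  partner-joins : ∀ {q r} → partner q ≡ just r → Joins G (chordAt q) (cyc q) (cyc r)
  partner-joins {q} eq with end₁ (chordAt q) ≟ᶠ cyc q | chordAt-incident q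
  ... | yes e₁≡q | _         = inj₁ (e₁≡q , map-position≡just eq)
  ... | no e₁≢q  | inj₁ e₁≡q = ⊥-elim (e₁≢q e₁≡q)
  ... | no _     | inj₂ e₂≡q = inj₂ (trans (sym (cyc-position _)) (cong cyc (just-injective eq)) , e₂≡q)

  joins-partner : ∀ {q r e} → Chord P e → Joins G e (cyc q) (cyc r) → partner q ≡ just r
  joins-partner {q} {r} e-chord joins with refl ← chordAt-unique (joins-incidentˡ G joins) e-chord
    with end₁ (chordAt q) ≟ᶠ cyc q | joins
  ... | yes _    | inj₁ (_ , e₂≡r) rewrite e₂≡r = cong just (position-cyc r)
  ... | yes e₁≡q | inj₂ (_ , e₂≡q) = ⊥-elim (noLoop _ _ e₂≡q (sym e₁≡q))
  ... | no e₁≢q  | inj₁ (e₁≡q , _) = ⊥-elim (e₁≢q e₁≡q)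
  ... | no _     | inj₂ (e₁≡r , _) = cong just (trans (cong position e₁≡r) (position-cyc r))

  partner-matching : IsMatching partner
  partner-matching = record
    { symmetric   = λ eq → joins-partner (chordAt-chord _) (swap (partner-joins eq))
    ; irreflexive = λ eq → joins-distinct G (partner-joins eq) refl
    }

  partner-dangling : ∀ {q} → Dangling G (chordAt q) → partner q ≡ nothing
  partner-dangling {q} dangling with end₁ (chordAt q) ≟ᶠ cyc q | chordAt-incident q
  ... | yes _   | _         rewrite dangling = refl
  ... | no e₁≢q | inj₁ e₁≡q = ⊥-elim (e₁≢q e₁≡q)
  ... | no _    | inj₂ e₂≡q = ⊥-elim (nothing≢just (trans (sym dangling) e₂≡q))

  partner-spokeEnd : ∀ {q s} → cyc q ≡ spokeEnd P s → partner q ≡ nothing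
  partner-spokeEnd {q} {s} q≡s =
    partner-dangling (subst (Dangling G) (chordAt-unique (inj₁ (sym q≡s)) (spoke-chord s)) (spoke-dangling s))

  data Side (q : Fin nV) : Fin nE → Set where
    outgoing : Side q (hEdge q)
    incoming : Side q (hEdge (prev q))
    chord    : Side q (chordAt q)

  side : ∀ {q e} → Incident G e (cyc q) → Side q e
  side {q} {e} inc with InH? e
  ... | yes (r , refl) with hEdge-incident inc
  ...   | inj₁ refl = outgoing
  ...   | inj₂ refl = incoming
  side {q} {e} inc | no ¬H with refl ← chordAt-unique inc ¬H = chord

  record CircuitColouring : Set where
    field
      circuitColour       : Fin nV → Fin 3
      chordColour         : Fin nV → Fin 3
      chordColour-partner : ∀ {q r} → partner q ≡ just r → chordColour q ≡ chordColour r
      distinct-at         : ∀ q → Distinct₃ (circuitColour q) (circuitColour (prev q)) (chordColour q)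

  module _ (C : CircuitColouring) where
    open CircuitColouring C

    colour : Fin nE → Fin 3
    colour e with InH? e
    ... | yes (r , _) = circuitColour r
    ... | no _        = chordColour (position (end₁ e))

    colour-hEdge : ∀ r → colour (hEdge r) ≡ circuitColour r
    colour-hEdge r with InH? (hEdge r)
    ... | yes (_ , eq) = cong circuitColour (hEdgeInj eq)
    ... | no ¬H        = ⊥-elim (¬H (r , refl))

    colour-chordAt : ∀ q → colour (chordAt q) ≡ chordColour q
    colour-chordAt q with InH? (chordAt q) | chordAt-incident q
    ... | yes H | _         = ⊥-elim (chordAt-chord q H)
    ... | no _  | inj₁ e₁≡q = cong chordColour (trans (cong position e₁≡q) (position-cyc q))
    ... | no _  | inj₂ e₂≡q =
      chordColour-partner (joins-partner (chordAt-chord q) (inj₁ (sym (cyc-position _) , e₂≡q)))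

    sideColour : ∀ {q e} → Side q e → Fin 3
    sideColour {q} outgoing = circuitColour q
    sideColour {q} incoming = circuitColour (prev q)
    sideColour {q} chord    = chordColour q

    colour-side : ∀ {q e} (s : Side q e) → colour e ≡ sideColour s
    colour-side {q} outgoing = colour-hEdge q
    colour-side {q} incoming = colour-hEdge (prev q)
    colour-side {q} chord    = colour-chordAt q

    sideColour-injective : ∀ {q e e'} (s : Side q e) (s' : Side q e') → sideColour s ≡ sideColour s' → e ≡ e'
    sideColour-injective {q} outgoing outgoing _  = refl
    sideColour-injective {q} outgoing incoming eq = ⊥-elim (proj₁ (distinct-at q) eq)
    sideColour-injective {q} outgoing chord    eq = ⊥-elim (proj₁ (proj₂ (distinct-at q)) eq)
    sideColour-injective {q} incoming outgoing eq = ⊥-elim (proj₁ (distinct-at q) (sym eq))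
    sideColour-injective {q} incoming incoming _  = refl
    sideColour-injective {q} incoming chord    eq = ⊥-elim (proj₂ (proj₂ (distinct-at q)) eq)
    sideColour-injective {q} chord    outgoing eq = ⊥-elim (proj₁ (proj₂ (distinct-at q)) (sym eq))
    sideColour-injective {q} chord    incoming eq = ⊥-elim (proj₂ (proj₂ (distinct-at q)) (sym eq))
    sideColour-injective {q} chord    chord    _  = refl

    colour-proper : EdgeColouring G colour
    colour-proper e e' v e≢e' e-inc e'-inc same =
      e≢e' (sideColour-injective s s' (trans (sym (colour-side s)) (trans same (colour-side s'))))
      where
      at-position : ∀ {e} → Incident G e v → Incident G e (cyc (position v))
      at-position = subst (Incident G _) (sym (cyc-position v))
      s  = side (at-position e-inc)
      s' = side (at-position e'-inc)

  circuitColouring⇒colourable : CircuitColouring → ThreeEdgeColourable G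
  circuitColouring⇒colourable C = colour C , colour-proper C

  coverOf : (Fin nE → Fin 3) → Fin 4 → Fin nE → Set
  coverOf col 0F e = col e ≡ 0F
  coverOf col 1F e = col e ≡ 1F
  coverOf col 2F e = col e ≡ 2F
  coverOf col 3F e = Chord P e

  colourable⇒proper4Cover : ThreeEdgeColourable G → HasProper4Cover P
  colourable⇒proper4Cover (col , proper) =
    coverOf col , perfect , (λ e → inject₁ (col e) , inColourClass refl) , (λ _ → id , id) , spoke-twice
    where
    perfect : ∀ k → PerfectMatching G (coverOf col k)
    perfect 0F = colourClass-perfectMatching G cubic proper 0F
    perfect 1F = colourClass-perfectMatching G cubic proper 1F
    perfect 2F = colourClass-perfectMatching G cubic proper 2F
    perfect 3F = chords-perfectMatching

    inColourClass : ∀ {c e} → col e ≡ c → coverOf col (inject₁ c) e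
    inColourClass {0F} eq = eq
    inColourClass {1F} eq = eq
    inColourClass {2F} eq = eq

    spoke-twice : ∀ s → ∃[ k ] ∃[ k' ] (k ≢ k' × coverOf col k (spoke s) × coverOf col k' (spoke s) ×
                                         (∀ k'' → coverOf col k'' (spoke s) → k'' ≡ k ⊎ k'' ≡ k'))
    spoke-twice s =
      inject₁ (col (spoke s)) , 3F , (λ eq → fromℕ≢inject₁ (sym eq)) , inColourClass refl , spoke-chord s , only
      where
      only : ∀ k → coverOf col k (spoke s) → k ≡ inject₁ (col (spoke s)) ⊎ k ≡ 3F
      only 0F eq = inj₁ (cong inject₁ (sym eq))
      only 1F eq = inj₁ (cong inject₁ (sym eq))
      only 2F eq = inj₁ (cong inject₁ (sym eq))
      only 3F _  = inj₂ refl

-- A segment of length 2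

-- On an odd circuit the paired edges form the matching τ, which covers every vertex
-- except the middle vertex of the segment.
paired : ℕ → Bool
paired 0             = false
paired 1             = false
paired (suc (suc t)) = even t

paired-suc : ∀ t → paired t ≡ true → paired (suc t) ≡ false
paired-suc (suc (suc t)) even-t = cong not even-t

-- The argument records whether the edge lies on the alternating path through the middle vertex.
pairColourOf : Bool → Fin 3
pairColourOf true  = 1F
pairColourOf false = 2F

chordColourOf : Bool → Fin 3
chordColourOf true  = 2F
chordColourOf false = 1F

-- Colours of the circuit edge leaving, and of the chord at, the vertex at offset t.  The
-- switch β = true gives colour 0 to the edge v_i b and the spoke at v_j, β = false to the
-- edge b v_j and the spoke at v_i; that spoke end must lie off the path.
edgeColour : Bool → ℕ → Bool → Fin 3
edgeColour β 0             _ = if β then 0F else 1F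
edgeColour β 1             _ = if β then 1F else 0F
edgeColour β (suc (suc t)) s = if even t then pairColourOf s else 0F

vertexChordColour : Bool → ℕ → Bool → Fin 3
vertexChordColour β 0 s = if β then chordColourOf s else 0F
vertexChordColour β 2 s = if β then 0F else chordColourOf s
vertexChordColour β _ s = chordColourOf s

edgeColour-paired : ∀ β t s → paired t ≡ true → edgeColour β t s ≡ pairColourOf s
edgeColour-paired β (suc (suc t)) s even-t rewrite even-t = refl

into-paired-distinct : ∀ s → Distinct₃ 0F (pairColourOf s) (chordColourOf s)
into-paired-distinct true  = (λ ()) , (λ ()) , (λ ())
into-paired-distinct false = (λ ()) , (λ ()) , (λ ())

out-of-paired-distinct : ∀ s → Distinct₃ (pairColourOf s) 0F (chordColourOf s)
out-of-paired-distinct true  = (λ ()) , (λ ()) , (λ ())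
out-of-paired-distinct false = (λ ()) , (λ ()) , (λ ())

start-distinct : ∀ β s → (β ≡ false → s ≡ false) →
                 Distinct₃ (edgeColour β 0 s) (pairColourOf s) (vertexChordColour β 0 s)
start-distinct true  s     _     = into-paired-distinct s
start-distinct false false _     = (λ ()) , (λ ()) , (λ ())
start-distinct false true  s-off = case s-off refl of λ ()

middle-distinct : ∀ β s s' → Distinct₃ (edgeColour β 1 s) (edgeColour β 0 s') (vertexChordColour β 1 true)
middle-distinct true  _ _ = (λ ()) , (λ ()) , (λ ())
middle-distinct false _ _ = (λ ()) , (λ ()) , (λ ())

end-distinct : ∀ β s s' → (β ≡ true → s ≡ false) →
               Distinct₃ (edgeColour β 2 s) (edgeColour β 1 s') (vertexChordColour β 2 s)
end-distinct false s     _ _     = out-of-paired-distinct s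
end-distinct true  false _ _     = (λ ()) , (λ ()) , (λ ())
end-distinct true  true  _ s-off = case s-off refl of λ ()

module LengthTwoSegment {G : Graph} (P : Ham3Pole G) {i j : Fin 3} {p : Fin (Graph.nV G)} (i≢j : i ≢ j)
  (p-spoke : Ham3Pole.cyc P p ≡ spokeEnd P i) (p+2-spoke : Ham3Pole.cyc P (next (next p)) ≡ spokeEnd P j) where
  open Graph G
  open Ham3Pole P
  open Circuit P

  off : Fin nV → ℕ
  off = offset p

  off-injective : ∀ {q r} → off q ≡ off r → q ≡ r
  off-injective = offset-injective p

  off-p : off p ≡ 0
  off-p = offset-self p

  p≢p+2 : p ≢ next (next p)
  p≢p+2 eq = i≢j (spokeEnd-injective (trans (sym p-spoke) (trans (cong cyc eq) p+2-spoke)))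

  off-p+1 : off (next p) ≡ 1
  off-p+1 with offset-next-cases p p
  ... | inj₁ eq = trans eq (cong suc off-p)
  ... | inj₂ eq = ⊥-elim (next≢ p (off-injective (trans eq (sym off-p))))

  off-p+2 : off (next (next p)) ≡ 2
  off-p+2 with offset-next-cases p (next p)
  ... | inj₁ eq = trans eq (cong suc off-p+1)
  ... | inj₂ eq = ⊥-elim (p≢p+2 (off-injective (trans off-p (sym eq))))

  off-prev : ∀ q → off q ≡ suc (off (prev q)) ⊎ q ≡ p
  off-prev q with offset-next-cases p (prev q)
  ... | inj₁ eq = inj₁ (subst (λ r → off r ≡ suc (off (prev q))) (next-prev q) eq)
  ... | inj₂ eq = inj₂ (off-injective (trans (subst (λ r → off r ≡ 0) (next-prev q) eq) (sym off-p)))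

  module OddCase (wrap-paired : paired (off (prev p)) ≡ true) where

    τ : Fin nV → Maybe (Fin nV)
    τ q with paired (off q) | paired (off (prev q))
    ... | true  | _     = just (next q)
    ... | false | true  = just (prev q)
    ... | false | false = nothing

    paired-not-consecutive : ∀ q → paired (off (prev q)) ≡ true → paired (off q) ≡ false
    paired-not-consecutive q into-paired with off-prev q
    ... | inj₁ eq   rewrite eq    = paired-suc (off (prev q)) into-paired
    ... | inj₂ refl rewrite off-p = refl

    τ-out : ∀ q → paired (off q) ≡ true → τ q ≡ just (next q)
    τ-out q out-paired rewrite out-paired = refl

    τ-into : ∀ q → paired (off (prev q)) ≡ true → τ q ≡ just (prev q)
    τ-into q into-paired rewrite paired-not-consecutive q into-paired | into-paired = refl

    τ-cases : ∀ {q r} → τ q ≡ just r → (paired (off q) ≡ true × next q ≡ r) ⊎ (paired (off (prev q)) ≡ true × prev q ≡ r)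
    τ-cases {q} eq with paired (off q) | paired (off (prev q))
    ... | true  | _    = inj₁ (refl , just-injective eq)
    ... | false | true = inj₂ (refl , just-injective eq)

    τ-matching : IsMatching τ
    τ-matching = record { symmetric = symmetric ; irreflexive = irreflexive }
      where
      symmetric : ∀ {q r} → τ q ≡ just r → τ r ≡ just q
      symmetric {q} eq with τ-cases eq
      ... | inj₁ (out-paired , refl) =
        trans (τ-into (next q) (subst (λ r → paired (off r) ≡ true) (sym (prev-next q)) out-paired)) (cong just (prev-next q))
      ... | inj₂ (into-paired , refl) = trans (τ-out (prev q) into-paired) (cong just (next-prev q))

      irreflexive : ∀ {q} → τ q ≢ just q
      irreflexive {q} eq with τ-cases eq
      ... | inj₁ (_ , nq≡q) = next≢ q nq≡q
      ... | inj₂ (_ , pq≡q) = prev≢ q pq≡q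

    τ-middle : τ (next p) ≡ nothing
    τ-middle rewrite off-p+1 | prev-next p | off-p = refl

    open AlternatingPath partner-matching τ-matching (next p) τ-middle

    onPath-prev : ∀ q → paired (off (prev q)) ≡ true → onPath (prev q) ≡ onPath q
    onPath-prev q into-paired = sym (onPath-step false (τ-into q into-paired))

    segment-end-off-path : onPath p ≡ false ⊎ onPath (next (next p)) ≡ false
    segment-end-off-path =
      σ-unmatched-separated (λ eq → next≢ p (sym eq)) (next≢ (next p)) p≢p+2
                            (partner-spokeEnd p-spoke) (partner-spokeEnd p+2-spoke)

    module Switch (β : Bool) (start-off : β ≡ false → onPath p ≡ false)
                  (end-off : β ≡ true → onPath (next (next p)) ≡ false) where

      matched-not-at : ∀ {q r r'} → partner q ≡ just r → off q ≡ off r' → partner r' ≡ nothing → ⊥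
      matched-not-at matched same unmatched =
        nothing≢just (trans (sym unmatched) (subst (λ x → partner x ≡ _) (off-injective same) matched))

      chordColour-matched : ∀ {q r} s → partner q ≡ just r → vertexChordColour β (off q) s ≡ chordColourOf s
      chordColour-matched {q} s matched with off q in off-q
      ... | 0                 = ⊥-elim (matched-not-at matched (trans off-q (sym off-p)) (partner-spokeEnd p-spoke))
      ... | 1                 = refl
      ... | 2                 = ⊥-elim (matched-not-at matched (trans off-q (sym off-p+2)) (partner-spokeEnd p+2-spoke))
      ... | suc (suc (suc _)) = refl

      DistinctAt : Fin nV → Set
      DistinctAt q = Distinct₃ (edgeColour β (off q) (onPath q)) (edgeColour β (off (prev q)) (onPath (prev q)))
                               (vertexChordColour β (off q) (onPath q))

      distinct-at-start : DistinctAt p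
      distinct-at-start =
        Distinct₃-cong (cong (λ t → edgeColour β t (onPath p)) off-p) wrap-colour
                       (cong (λ t → vertexChordColour β t (onPath p)) off-p)
                       (start-distinct β (onPath p) start-off)
        where
        wrap-colour : edgeColour β (off (prev p)) (onPath (prev p)) ≡ pairColourOf (onPath p)
        wrap-colour = trans (edgeColour-paired β (off (prev p)) (onPath (prev p)) wrap-paired)
                            (cong pairColourOf (onPath-prev p wrap-paired))

      distinct-after : ∀ q t → off (prev q) ≡ t →
                       Distinct₃ (edgeColour β (suc t) (onPath q)) (edgeColour β t (onPath (prev q)))
                                 (vertexChordColour β (suc t) (onPath q))
      distinct-after q 0 off-prev-q =
        Distinct₃-cong refl refl (cong chordColourOf on-path) (middle-distinct β (onPath q) (onPath (prev q)))
        where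
        on-path : onPath q ≡ true
        on-path = subst (λ r → onPath r ≡ true) (sym (prev⇒next (off-injective (trans off-prev-q (sym off-p)))))
                        onPath-start
      distinct-after q 1 off-prev-q = end-distinct β (onPath q) (onPath (prev q)) λ β≡true →
        subst (λ r → onPath r ≡ false) (sym (prev⇒next (off-injective (trans off-prev-q (sym off-p+1)))))
              (end-off β≡true)
      distinct-after q (suc (suc m)) off-prev-q with even m in even-m
      ... | true rewrite onPath-prev q (trans (cong paired off-prev-q) even-m) = into-paired-distinct (onPath q)
      ... | false = out-of-paired-distinct (onPath q)

      distinct-at : ∀ q → DistinctAt q
      distinct-at q with off-prev q
      ... | inj₁ off-q rewrite off-q = distinct-after q (off (prev q)) refl
      ... | inj₂ q≡p = subst DistinctAt (sym q≡p) distinct-at-start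

      colouring : CircuitColouring
      colouring = record
        { circuitColour       = λ q → edgeColour β (off q) (onPath q)
        ; chordColour         = λ q → vertexChordColour β (off q) (onPath q)
        ; chordColour-partner = λ matched →
            trans (chordColour-matched _ matched)
              (trans (cong chordColourOf (onPath-step true matched))
                (sym (chordColour-matched _ (IsMatching.symmetric partner-matching matched))))
        ; distinct-at         = distinct-at
        }

    colouring : CircuitColouring
    colouring with segment-end-off-path
    ... | inj₁ start-off = Switch.colouring false (λ _ → start-off) (λ ())
    ... | inj₂ end-off   = Switch.colouring true (λ ()) (λ _ → end-off)

  -- This is the case of an even circuit, which the handshake lemma excludes for a cubic
  -- 3-pole; colouring it is shorter than excluding it.
  module EvenCase (wrap-unpaired : paired (off (prev p)) ≡ false) where

    parityColour : Bool → Fin 3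
    parityColour true  = 0F
    parityColour false = 1F

    alternating-distinct : ∀ b → Distinct₃ (parityColour (not b)) (parityColour b) 2F
    alternating-distinct true  = (λ ()) , (λ ()) , (λ ())
    alternating-distinct false = (λ ()) , (λ ()) , (λ ())

    wrap-odd : even (off (prev p)) ≡ false
    wrap-odd with off (prev p) in off-prev-p
    ... | 0           = ⊥-elim (prev≢ p (off-injective (trans off-prev-p (sym off-p))))
    ... | 1           = ⊥-elim (p≢p+2 (prev⇒next (off-injective (trans off-prev-p (sym off-p+1)))))
    ... | suc (suc m) = trans (not-involutive (even m)) wrap-unpaired

    distinct-at : ∀ q → Distinct₃ (parityColour (even (off q))) (parityColour (even (off (prev q)))) 2F
    distinct-at q with off-prev q
    ... | inj₁ off-q rewrite off-q = alternating-distinct (even (off (prev q)))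
    ... | inj₂ refl =
      Distinct₃-cong (cong (parityColour ∘ even) off-p) (cong parityColour wrap-odd) refl ((λ ()) , (λ ()) , (λ ()))

    colouring : CircuitColouring
    colouring = record
      { circuitColour       = λ q → parityColour (even (off q))
      ; chordColour         = λ _ → 2F
      ; chordColour-partner = λ _ → refl
      ; distinct-at         = distinct-at
      }

lemma3p4 : (G : Graph) (P : Ham3Pole G) → HasSegmentOfLength2 P →
    ThreeEdgeColourable G × HasProper4Cover P
lemma3p4 G P (i , j , p , i≢j , p-spoke , _ , p+2-spoke) = colourable , colourable⇒proper4Cover colourable
  where
  open Circuit P
  open LengthTwoSegment P i≢j p-spoke p+2-spoke

  colouring : CircuitColouring
  colouring with paired (off (prev p)) in wrap
  ... | true  = OddCase.colouring wrap
  ... | false = EvenCase.colouring wrap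

  colourable : ThreeEdgeColourable G
  colourable = circuitColouring⇒colourable colouring
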